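{- Every $\omega\psi$-perfect graph is $\omega\chi$-perfect; that is, if $G$ is a finite graph with $\omega(H)=\psi(H)$ for every induced subgraph $H$ of $G$, then $\omega(H)=\chi(H)$ for every induced subgraph $H$ of $G$.
   Context: All graphs are finite and simple. A $k$-coloring of $G$ is a surjective map $\varsigma\colon V(G)\to\{1,\dots,k\}$; it is complete if for every pair of distinct colors $i,j$ there is an edge $xy$ with $\varsigma(x)=i$, $\varsigma(y)=j$. The pseudoachromatic number $\psi(G)$ is the largest $k$ for which $G$ admits a complete $k$-coloring. $\omega(G)$ is the clique number and $\chi(G)$ the chromatic number. For parameters $a,b$, $G$ is $ab$-perfect if $a(H)=b(H)$ for all induced subgraphs $H$ of $G$. -}

module Defs where

open import Data.Nat using (ℕ; _≤_; _≥_)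
open import Data.Fin using (Fin)
open import Data.Bool using (Bool; true; false)
open import Data.Product using (Σ; ∃; _×_; _,_)
open import Relation.Binary.PropositionalEquality using (_≡_; _≢_)
open import Function.Definitions using (Injective; Surjective)

record Graph : Set where
  field
    n     : ℕ
    adj   : Fin n → Fin n → Bool
    sym   : ∀ x y → adj x y ≡ adj y x
    irrefl : ∀ x → adj x x ≡ false

open Graph public

Edge : (G : Graph) → Fin (n G) → Fin (n G) → Set
Edge G x y = adj G x y ≡ true

-- Induced subgraph of G on the image of an injective map f : Fin m → Fin (n G)
-- (every induced subgraph arises this way, up to isomorphism).
induced : (G : Graph) {m : ℕ} (f : Fin m → Fin (n G)) → Graph
induced G {m} f = record
  { n = m
  ; adj = λ x y → adj G (f x) (f y)
  ; sym = λ x y → sym G (f x) (f y)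
  ; irrefl = λ x → irrefl G (f x)
  }

IsMax : (ℕ → Set) → ℕ → Set
IsMax P k = P k × (∀ m → P m → m ≤ k)

IsMin : (ℕ → Set) → ℕ → Set
IsMin P k = P k × (∀ m → P m → k ≤ m)

HasClique : Graph → ℕ → Set
HasClique G k = Σ (Fin k → Fin (n G)) λ f →
  Injective _≡_ _≡_ f × (∀ i j → i ≢ j → Edge G (f i) (f j))

HasProperColoring : Graph → ℕ → Set
HasProperColoring G k = Σ (Fin (n G) → Fin k) λ c →
  ∀ x y → Edge G x y → c x ≢ c y

IsCompleteColoring : (G : Graph) (k : ℕ) → (Fin (n G) → Fin k) → Set
IsCompleteColoring G k c =
  Surjective _≡_ _≡_ c ×
  (∀ i j → i ≢ j → ∃ λ x → ∃ λ y → Edge G x y × c x ≡ i × c y ≡ j)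

HasCompleteColoring : Graph → ℕ → Set
HasCompleteColoring G k = Σ (Fin (n G) → Fin k) (IsCompleteColoring G k)

IsCliqueNumber : Graph → ℕ → Set
IsCliqueNumber G = IsMax (HasClique G)

IsChromaticNumber : Graph → ℕ → Set
IsChromaticNumber G = IsMin (HasProperColoring G)

IsPseudoachromaticNumber : Graph → ℕ → Set
IsPseudoachromaticNumber G = IsMax (HasCompleteColoring G)

ωψ-equal : Graph → Set
ωψ-equal H = ∃ λ k → IsCliqueNumber H k × IsPseudoachromaticNumber H k

ωχ-equal : Graph → Set
ωχ-equal H = ∃ λ k → IsCliqueNumber H k × IsChromaticNumber H k

Perfect : (Graph → Set) → Graph → Set
Perfect P G = ∀ {m} (f : Fin m → Fin (n G)) → Injective _≡_ _≡_ f → P (induced G f)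

ωψ-perfect : Graph → Set
ωψ-perfect = Perfect ωψ-equal

ωχ-perfect : Graph → Set
ωχ-perfect = Perfect ωχ-equal

module Submission where

-- For every graph H we have  ω(H) ≤ χ(H) ≤ ψ(H):
--   * a clique of size k is mapped injectively by any proper colouring,
--     so it needs at least k colours;
--   * every proper colouring can be turned into one that is proper AND
--     complete: while some colour is unused, delete it, and while two
--     colour classes are joined by no edge, merge them (the result is still
--     proper).  Each step removes one colour, so the process terminates in
--     a proper complete colouring with some j colours, whence χ ≤ j ≤ ψ.
-- Hence ω(H) = ψ(H) forces ω(H) = χ(H), and applying this to every induced
-- subgraph gives the corollary.

open import Defs
open import Data.Nat using (ℕ; zero; suc; _≤_)
open import Data.Fin using (Fin; punchOut; inject≤; _≟_)
open import Data.Fin.Properties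
  using (punchOut-injective; inject≤-injective; injective⇒≤; any?)
open import Data.Bool using (true; false)
open import Data.Product using (Σ; ∃; _×_; _,_; proj₁)
open import Data.Sum using (_⊎_; inj₁; inj₂)
open import Data.Empty using (⊥-elim)
open import Relation.Nullary using (¬_; Dec; yes; no)
open import Relation.Nullary.Decidable using (¬?; _×-dec_)
open import Relation.Binary.PropositionalEquality
  using (_≡_; _≢_; refl; trans) renaming (sym to ≡-sym)
open import Function.Definitions using (Injective; Surjective)

IsProper : (H : Graph) {k : ℕ} → (Fin (n H) → Fin k) → Set
IsProper H c = ∀ x y → Edge H x y → c x ≢ c y

Joined : (H : Graph) {k : ℕ} → (Fin (n H) → Fin k) → Fin k → Fin k → Set
Joined H c i j = ∃ λ x → ∃ λ y → Edge H x y × c x ≡ i × c y ≡ j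

HasProperCompleteColoring : Graph → ℕ → Set
HasProperCompleteColoring H k =
  Σ (Fin (n H) → Fin k) λ c → IsProper H c × IsCompleteColoring H k c

-- ω ≤ χ: a proper colouring is injective on a clique.
clique≤colours : (H : Graph) {k m : ℕ} →
                 HasClique H k → HasProperColoring H m → k ≤ m
clique≤colours H (f , _ , clique) (c , proper) = injective⇒≤ c∘f-injective
  where
  c∘f-injective : Injective _≡_ _≡_ (λ i → c (f i))
  c∘f-injective {i} {j} same with i ≟ j
  ... | yes i≡j = i≡j
  ... | no  i≢j = ⊥-elim (proper (f i) (f j) (clique i j i≢j) same)

widen-coloring : (H : Graph) {j k : ℕ} → j ≤ k →
                 HasProperColoring H j → HasProperColoring H k
widen-coloring H j≤k (c , proper) =
  (λ x → inject≤ (c x) j≤k) ,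
  λ x y e same → proper x y e (inject≤-injective j≤k j≤k _ _ same)

-- The identity is a proper colouring (H has no loops), so χ(H) ≤ n(H).
identity-proper : (H : Graph) → IsProper H (λ x → x)
identity-proper H x .x e refl with trans (≡-sym (irrefl H x)) e
... | ()

edge? : (H : Graph) (x y : Fin (n H)) → Dec (Edge H x y)
edge? H x y with adj H x y
... | true  = yes refl
... | false = no λ ()

joined? : (H : Graph) {k : ℕ} (c : Fin (n H) → Fin k) (i j : Fin k) →
          Dec (Joined H c i j)
joined? H c i j =
  any? λ x → any? λ y → edge? H x y ×-dec ((c x ≟ i) ×-dec (c y ≟ j))

drop-unused-colour : (H : Graph) {m : ℕ} (c : Fin (n H) → Fin (suc m)) →
                     IsProper H c → (i : Fin (suc m)) → (∀ x → i ≢ c x) →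
                     Σ (Fin (n H) → Fin m) (IsProper H)
drop-unused-colour H c proper i unused =
  (λ x → punchOut (unused x)) ,
  λ x y e same → proper x y e (punchOut-injective (unused x) (unused y) same)

module MergeColours {m : ℕ} (i j : Fin (suc m)) (i≢j : i ≢ j) where

  merge : Fin (suc m) → Fin m
  merge v with v ≟ j
  ... | yes _   = punchOut (λ j≡i → i≢j (≡-sym j≡i))
  ... | no  v≢j = punchOut (λ j≡v → v≢j (≡-sym j≡v))

  merge-identifies : ∀ v w → merge v ≡ merge w →
                     v ≡ w ⊎ ((v ≡ j × w ≡ i) ⊎ (v ≡ i × w ≡ j))
  merge-identifies v w same with v ≟ j | w ≟ j
  ... | yes v≡j | yes w≡j = inj₁ (trans v≡j (≡-sym w≡j))
  ... | yes v≡j | no  w≢j =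
    inj₂ (inj₁ (v≡j , ≡-sym (punchOut-injective _ (λ j≡w → w≢j (≡-sym j≡w)) same)))
  ... | no  v≢j | yes w≡j =
    inj₂ (inj₂ (punchOut-injective (λ j≡v → v≢j (≡-sym j≡v)) _ same , w≡j))
  ... | no  v≢j | no  w≢j =
    inj₁ (punchOut-injective (λ j≡v → v≢j (≡-sym j≡v)) (λ j≡w → w≢j (≡-sym j≡w)) same)

merge-unjoined : (H : Graph) {m : ℕ} (c : Fin (n H) → Fin (suc m)) →
                 IsProper H c → (i j : Fin (suc m)) → i ≢ j →
                 ¬ Joined H c i j → Σ (Fin (n H) → Fin m) (IsProper H)
merge-unjoined H c proper i j i≢j unjoined =
  (λ x → merge (c x)) , merged-proper
  where
  open MergeColours i j i≢j
  merged-proper : IsProper H (λ x → merge (c x))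
  merged-proper x y e same with merge-identifies (c x) (c y) same
  ... | inj₁ cx≡cy               = proper x y e cx≡cy
  ... | inj₂ (inj₁ (cx≡j , cy≡i)) =
    unjoined (y , x , trans (Graph.sym H y x) e , cy≡i , cx≡j)
  ... | inj₂ (inj₂ (cx≡i , cy≡j)) = unjoined (x , y , e , cx≡i , cy≡j)

shrink-or-complete : (H : Graph) {m : ℕ} (c : Fin (n H) → Fin (suc m)) →
                     IsProper H c →
                     Σ (Fin (n H) → Fin m) (IsProper H) ⊎
                     IsCompleteColoring H (suc m) c
shrink-or-complete H c proper
  with any? (λ i → ¬? (any? (λ x → c x ≟ i)))
... | yes (i , unused) =
  inj₁ (drop-unused-colour H c proper i (λ x i≡cx → unused (x , ≡-sym i≡cx)))
... | no all-used
  with any? (λ i → any? (λ j → ¬? (i ≟ j) ×-dec ¬? (joined? H c i j)))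
... | yes (i , j , i≢j , unjoined) =
  inj₁ (merge-unjoined H c proper i j i≢j unjoined)
... | no all-joined = inj₂ (surjective , complete)
  where
  surjective : Surjective _≡_ _≡_ c
  surjective i with any? (λ x → c x ≟ i)
  ... | yes (x , cx≡i) = x , λ { refl → cx≡i }
  ... | no  unused     = ⊥-elim (all-used (i , unused))
  complete : ∀ i j → i ≢ j → Joined H c i j
  complete i j i≢j with joined? H c i j
  ... | yes joined   = joined
  ... | no  unjoined = ⊥-elim (all-joined (i , j , i≢j , unjoined))

-- Every proper colouring can be reduced to a proper complete colouring
-- (with zero colours the empty colouring is vacuously complete).
proper-complete-from : (H : Graph) (m : ℕ) (c : Fin (n H) → Fin m) →
                       IsProper H c → ∃ (HasProperCompleteColoring H)
proper-complete-from H zero    c proper = zero , c , proper , (λ ()) , (λ ())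
proper-complete-from H (suc m) c proper with shrink-or-complete H c proper
... | inj₁ (d , d-proper) = proper-complete-from H m d d-proper
... | inj₂ complete       = suc m , c , proper , complete

proper-complete-exists : (H : Graph) → ∃ (HasProperCompleteColoring H)
proper-complete-exists H = proper-complete-from H (n H) (λ x → x) (identity-proper H)

-- ω = ψ implies ω = χ: the common value k bounds χ from below (clique
-- bound) and from above (χ ≤ j ≤ ψ = k).
ωψ⇒ωχ : (H : Graph) → ωψ-equal H → ωχ-equal H
ωψ⇒ωχ H (k , ω , (_ , ψ-max)) with proper-complete-exists H
... | j , c , proper , complete =
  k , ω , (k-colouring , λ m → clique≤colours H (proj₁ ω))
  where
  k-colouring : HasProperColoring H k
  k-colouring = widen-coloring H (ψ-max j (c , complete)) (c , proper)

corollary3 : (G : Graph) → ωψ-perfect G → ωχ-perfect G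
corollary3 G ωψ f f-injective = ωψ⇒ωχ (induced G f) (ωψ f f-injective)
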